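{- Let $G$ be any orientation of the complete graph $K_3$ on vertices $v_1,v_2,v_3$. Then for every integer $n\geq 3$ there exists a realization of $G$ using $n$-sided dice.
   Context: For an orientation $G$ of the complete graph $K_m$ on vertex set $\{v_1,\dots,v_m\}$, a realization of $G$ by $n$-sided dice is an $m$-tuple of pairwise disjoint sets $A_1,\dots,A_m$, each of size $n$, with $A_1\cup\dots\cup A_m=\{1,\dots,mn\}$ (each $A_i$ viewed as a fair die labeled by its elements, dice rolled independently), such that for all $i\neq j$: $P(A_i\succ A_j)>1/2$ if and only if $(v_i\to v_j)$ is an edge of $G$. Here $P(X\succ Y)=\frac{1}{n^2}|\{(x,y)\in X\times Y: x>y\}|$. -}

module Defs where

open import Data.Nat using (ℕ; suc; _*_; _<_; _≤_; _<?_)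
open import Data.Fin using (Fin)
open import Data.Product using (_×_; _,_; Σ; ∃)
open import Data.List using (List; length; filter; cartesianProduct)
open import Data.List.Base using (allFin)
open import Data.Bool using (Bool; true; false)
open import Relation.Binary.PropositionalEquality using (_≡_; _≢_)

-- An orientation of the complete graph K_m on vertex set Fin m:
-- E i j ≡ true means the edge is directed i → j.
record Orientation (m : ℕ) : Set where
  field
    E        : Fin m → Fin m → Bool
    loopless : ∀ i → E i i ≡ false
    tournament : ∀ i j → i ≢ j → E i j ≢ E j i

Die : ℕ → Set
Die n = Fin n → ℕ

-- |{(x,y) ∈ X × Y : x > y}| (counted over face pairs; labels are distinct
-- in a realization, so this is the cardinality from the paper).
wins : ∀ {n} → Die n → Die n → ℕ
wins {n} X Y = length (filter (λ p → Y (Data.Product.proj₂ p) <? X (Data.Product.proj₁ p))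
                              (cartesianProduct (allFin n) (allFin n)))

-- P(X ≻ Y) > 1/2  ⇔  wins X Y / n² > 1/2  ⇔  n² < 2 · wins X Y
Beats : ∀ {n} → Die n → Die n → Set
Beats {n} X Y = n * n < 2 * wins X Y

-- An m-tuple of n-sided dice A_1..A_m forming a partition of {1,…,mn}
-- into pairwise disjoint sets of size n: the labelling (i,k) ↦ A i k is
-- injective with values in {1,…,mn} (hence, by counting, a bijection onto it).
record IsPartitionDice (m n : ℕ) (A : Fin m → Die n) : Set where
  field
    injective : ∀ i j k l → A i k ≡ A j l → (i ≡ j × k ≡ l)
    range     : ∀ i k → 1 ≤ A i k × A i k ≤ m * n
    surjective : ∀ v → 1 ≤ v → v ≤ m * n → ∃ λ i → ∃ λ k → A i k ≡ v

record Realization {m : ℕ} (G : Orientation m) (n : ℕ) : Set where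
  field
    dice      : Fin m → Die n
    partition : IsPartitionDice m n dice
    correct   : ∀ i j → i ≢ j →
                  (Beats (dice i) (dice j) → Orientation.E G i j ≡ true) ×
                  (Orientation.E G i j ≡ true → Beats (dice i) (dice j))

-- Give the i-th die (0 ≤ i < m) of a realization by n-sided dice the two new top faces mn + i + 1 and
-- mn + 2m − i.  Each new face beats every old face, and among the new faces any two dice beat each other
-- exactly twice, so 2·wins − n² is unchanged for every pair: a realization with n sides yields one with
-- n + 2 sides.  It remains to realize the eight orientations of K₃ with 3- and 4-sided dice, which is a
-- finite computation.
module Submission where

open import Data.Bool using (Bool; true; false; not)
import Data.Bool.Properties as Bool
open import Data.Fin using (Fin; zero; suc; toℕ; fromℕ<; _↑ˡ_; _↑ʳ_; splitAt; join; opposite)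
open import Data.Fin.Patterns using (0F; 1F; 2F)
open import Data.Fin.Properties using (all?; any?)
import Data.Fin.Properties as Fin
import Data.List as List
open import Data.List using (length; filter; cartesianProduct; map; _++_; tabulate)
open import Data.List.Properties using (length-++; filter-++; filter-accept; filter-reject)
open import Data.Nat using (ℕ; zero; suc; _+_; _*_; _∸_; _≤_; _<_; _≤?_; _<?_; s≤s; z≤n)
open import Data.Nat.Properties
open import Data.Nat.Tactic.RingSolver using (solve-∀)
open import Algebra.Properties.CommutativeSemigroup +-commutativeSemigroup using (interchange)
open import Data.Product using (_×_; _,_; proj₁; proj₂; ∃)
open import Data.Sum using (inj₁; inj₂)
open import Data.Vec.Functional using ([]; _∷_)
open import Defs
open import Function using (_∘_; id; _⇔_; mk⇔; Equivalence)
open import Relation.Binary.Definitions using (tri<; tri≈; tri>)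
open import Relation.Binary.PropositionalEquality
open import Relation.Nullary using (Dec; yes; no; does; ¬?; contradiction)
open import Relation.Nullary.Decidable using (True; toWitness; map′; _×-dec_; _→-dec_)

countBelow : ∀ {n} → Die n → ℕ → ℕ
countBelow Y v = length (filter (_<? v) (tabulate Y))

winCount : ∀ {k n} → Die k → Die n → ℕ
winCount {zero}  X Y = 0
winCount {suc k} X Y = countBelow Y (X zero) + winCount (X ∘ suc) Y

module _ {n : ℕ} (X Y : Die n) where

  private
    P = λ (p : Fin n × Fin n) → Y (proj₂ p) <? X (proj₁ p)

    filter-row : ∀ x ys → length (filter P (map (x ,_) ys)) ≡ length (filter (λ y → Y y <? X x) ys)
    filter-row x List.[] = refl
    filter-row x (y List.∷ ys) with does (Y y <? X x)
    ... | true  = cong suc (filter-row x ys)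
    ... | false = filter-row x ys

    filter-column : ∀ {k} (h : Fin k → Fin n) v →
      length (filter (λ y → Y y <? v) (tabulate h)) ≡ countBelow (Y ∘ h) v
    filter-column {zero}  h v = refl
    filter-column {suc k} h v with does (Y (h zero) <? v)
    ... | true  = cong suc (filter-column (h ∘ suc) v)
    ... | false = filter-column (h ∘ suc) v

    filter-grid : ∀ {k} (g : Fin k → Fin n) →
      length (filter P (cartesianProduct (tabulate g) (tabulate id))) ≡ winCount (X ∘ g) Y
    filter-grid {zero}  g = refl
    filter-grid {suc k} g = begin
      length (filter P (row ++ rest))                ≡⟨ cong length (filter-++ P row rest) ⟩
      length (filter P row ++ filter P rest)         ≡⟨ length-++ (filter P row) ⟩
      length (filter P row) + length (filter P rest) ≡⟨ cong₂ _+_ row-count (filter-grid (g ∘ suc)) ⟩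
      winCount (X ∘ g) Y                             ∎
        where
        open ≡-Reasoning
        row  = map (g zero ,_) (tabulate id)
        rest = cartesianProduct (tabulate (g ∘ suc)) (tabulate id)
        row-count = trans (filter-row (g zero) (tabulate id)) (filter-column id (X (g zero)))

  wins≡winCount : wins X Y ≡ winCount X Y
  wins≡winCount = filter-grid id

-- Data.Vec.Functional._++_, but by recursion on k so that (P ⊕ X) ∘ suc reduces to P ∘ suc ⊕ X.
infixr 5 _⊕_
_⊕_ : ∀ {k n} → Die k → Die n → Die (k + n)
_⊕_ {zero}  P X = X
_⊕_ {suc k} P X = P zero ∷ (P ∘ suc ⊕ X)

module _ {n : ℕ} {c v : ℕ} {Y : Die n} where

  countBelow-∷-< : c < v → countBelow (c ∷ Y) v ≡ suc (countBelow Y v)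
  countBelow-∷-< c<v = cong length (filter-accept (_<? v) c<v)

  countBelow-∷-≥ : v ≤ c → countBelow (c ∷ Y) v ≡ countBelow Y v
  countBelow-∷-≥ v≤c = cong length (filter-reject (_<? v) (≤⇒≯ v≤c))

countBelow-all : ∀ {n} {Y : Die n} {v} → (∀ b → Y b < v) → countBelow Y v ≡ n
countBelow-all {zero}  below = refl
countBelow-all {suc n} below = trans (countBelow-∷-< (below zero)) (cong suc (countBelow-all (below ∘ suc)))

countBelow-none : ∀ {n} {Y : Die n} {v} → (∀ b → v ≤ Y b) → countBelow Y v ≡ 0
countBelow-none {zero}  above = refl
countBelow-none {suc n} above = trans (countBelow-∷-≥ (above zero)) (countBelow-none (above ∘ suc))

tabulate-⊕ : ∀ {k n} (Q : Die k) (Y : Die n) → tabulate (Q ⊕ Y) ≡ tabulate Q ++ tabulate Y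
tabulate-⊕ {zero}  Q Y = refl
tabulate-⊕ {suc k} Q Y = cong (Q zero List.∷_) (tabulate-⊕ (Q ∘ suc) Y)

countBelow-⊕ : ∀ {k n} (Q : Die k) (Y : Die n) v → countBelow (Q ⊕ Y) v ≡ countBelow Q v + countBelow Y v
countBelow-⊕ Q Y v = begin
  length (filter (_<? v) (tabulate (Q ⊕ Y)))                 ≡⟨ cong (length ∘ filter (_<? v)) (tabulate-⊕ Q Y) ⟩
  length (filter (_<? v) (tabulate Q ++ tabulate Y))         ≡⟨ cong length (filter-++ (_<? v) (tabulate Q) _) ⟩
  length (filter (_<? v) (tabulate Q) ++ filter (_<? v) (tabulate Y))
                                                             ≡⟨ length-++ (filter (_<? v) (tabulate Q)) ⟩
  countBelow Q v + countBelow Y v                            ∎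
  where open ≡-Reasoning

countBelow-+ : ∀ {n} (Y : Die n) c v → countBelow ((c +_) ∘ Y) (c + v) ≡ countBelow Y v
countBelow-+ {zero}  Y c v = refl
countBelow-+ {suc n} Y c v with Y zero <? v
... | yes y<v = trans (countBelow-∷-< (+-monoʳ-< c y<v))
                  (trans (cong suc (countBelow-+ (Y ∘ suc) c v)) (sym (countBelow-∷-< y<v)))
... | no  y≮v = trans (countBelow-∷-≥ (+-monoʳ-≤ c (≮⇒≥ y≮v)))
                  (trans (countBelow-+ (Y ∘ suc) c v) (sym (countBelow-∷-≥ (≮⇒≥ y≮v))))

winCount-⊕ˡ : ∀ {k l n} (P : Die k) (X : Die l) (Z : Die n) → winCount (P ⊕ X) Z ≡ winCount P Z + winCount X Z
winCount-⊕ˡ {zero}  P X Z = refl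
winCount-⊕ˡ {suc k} P X Z = trans (cong (countBelow Z (P zero) +_) (winCount-⊕ˡ (P ∘ suc) X Z))
                                  (sym (+-assoc (countBelow Z (P zero)) _ _))

winCount-⊕ʳ : ∀ {k l n} (X : Die k) (Q : Die l) (Y : Die n) → winCount X (Q ⊕ Y) ≡ winCount X Q + winCount X Y
winCount-⊕ʳ {zero}  X Q Y = refl
winCount-⊕ʳ {suc k} X Q Y = trans (cong₂ _+_ (countBelow-⊕ Q Y (X zero)) (winCount-⊕ʳ (X ∘ suc) Q Y))
                                  (interchange (countBelow Q (X zero)) _ _ _)

winCount-all : ∀ {k n} {X : Die k} {Y : Die n} → (∀ a b → Y b < X a) → winCount X Y ≡ k * n
winCount-all {zero}  beats = refl
winCount-all {suc k} beats = cong₂ _+_ (countBelow-all (beats zero)) (winCount-all (beats ∘ suc))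

winCount-none : ∀ {k n} {X : Die k} {Y : Die n} → (∀ a b → X a ≤ Y b) → winCount X Y ≡ 0
winCount-none {zero}  loses = refl
winCount-none {suc k} loses = cong₂ _+_ (countBelow-none (loses zero)) (winCount-none (loses ∘ suc))

winCount-+ : ∀ {k n} (X : Die k) (Y : Die n) c → winCount ((c +_) ∘ X) ((c +_) ∘ Y) ≡ winCount X Y
winCount-+ {zero}  X Y c = refl
winCount-+ {suc k} X Y c = cong₂ _+_ (countBelow-+ Y c (X zero)) (winCount-+ (X ∘ suc) Y c)

winCount-stack : ∀ {k l n} {P Q : Die k} {X : Die l} {Y : Die n} {t} →
  (∀ a → X a ≤ t) → (∀ b → Y b ≤ t) → (∀ a → t < P a) → (∀ b → t < Q b) →
  winCount (P ⊕ X) (Q ⊕ Y) ≡ winCount P Q + (k * n + winCount X Y)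
winCount-stack {k} {n = n} {P} {Q} {X} {Y} X≤t Y≤t t<P t<Q = begin
  winCount (P ⊕ X) (Q ⊕ Y)
    ≡⟨ winCount-⊕ˡ P X (Q ⊕ Y) ⟩
  winCount P (Q ⊕ Y) + winCount X (Q ⊕ Y)
    ≡⟨ cong₂ _+_ (winCount-⊕ʳ P Q Y) (winCount-⊕ʳ X Q Y) ⟩
  (winCount P Q + winCount P Y) + (winCount X Q + winCount X Y)
    ≡⟨ cong₂ (λ a b → (winCount P Q + a) + (b + winCount X Y)) P-beats-Y X-loses-Q ⟩
  (winCount P Q + k * n) + winCount X Y
    ≡⟨ +-assoc (winCount P Q) _ _ ⟩
  winCount P Q + (k * n + winCount X Y)
    ∎
  where
  open ≡-Reasoning
  P-beats-Y = winCount-all λ a b → ≤-<-trans (Y≤t b) (t<P a)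
  X-loses-Q = winCount-none λ a b → <⇒≤ (≤-<-trans (X≤t a) (t<Q b))

⊕-↑ˡ : ∀ {k n} (P : Die k) (X : Die n) a → (P ⊕ X) (a ↑ˡ n) ≡ P a
⊕-↑ˡ {suc k} P X zero    = refl
⊕-↑ˡ {suc k} P X (suc a) = ⊕-↑ˡ (P ∘ suc) X a

⊕-↑ʳ : ∀ {k n} (P : Die k) (X : Die n) b → (P ⊕ X) (k ↑ʳ b) ≡ X b
⊕-↑ʳ {zero}  P X b = refl
⊕-↑ʳ {suc k} P X b = ⊕-↑ʳ (P ∘ suc) X b

module _ {m k n : ℕ} (B : Fin m → Die k) (A : Fin m → Die n) where

  stackDice : Fin m → Die (k + n)
  stackDice i = (m * n +_) ∘ B i ⊕ A i

  stackDice-↑ˡ : ∀ i a → stackDice i (a ↑ˡ n) ≡ m * n + B i a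
  stackDice-↑ˡ i a = ⊕-↑ˡ ((m * n +_) ∘ B i) (A i) a

  stackDice-↑ʳ : ∀ i b → stackDice i (k ↑ʳ b) ≡ A i b
  stackDice-↑ʳ i b = ⊕-↑ʳ ((m * n +_) ∘ B i) (A i) b

  stack-partition : IsPartitionDice m k B → IsPartitionDice m n A → IsPartitionDice m (k + n) stackDice
  stack-partition pB pA = record
    { injective  = λ i j → joined λ s → joined λ t → injective-joined i j s t
    ; range      = λ i → joined (range-joined i)
    ; surjective = surjective′
    }
    where
    module B = IsPartitionDice pB
    module A = IsPartitionDice pA
    c = m * n

    joined : ∀ {P : Fin (k + n) → Set} → (∀ s → P (join k n s)) → ∀ f → P f
    joined {P} h f = subst P (Fin.join-splitAt k n f) (h (splitAt k f))

    c+mk≡m[k+n] : c + m * k ≡ m * (k + n)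
    c+mk≡m[k+n] = trans (+-comm c (m * k)) (sym (*-distribˡ-+ m k n))

    old<new : ∀ i j a b → A i a < c + B j b
    old<new i j a b = ≤-<-trans (proj₂ (A.range i a)) (m<m+n c (proj₁ (B.range j b)))

    injective-joined : ∀ i j s t → stackDice i (join k n s) ≡ stackDice j (join k n t) →
                       i ≡ j × join k n s ≡ join k n t
    injective-joined i j (inj₁ a) (inj₁ b) e
      with B.injective i j a b (+-cancelˡ-≡ c _ _ (trans (sym (stackDice-↑ˡ i a)) (trans e (stackDice-↑ˡ j b))))
    ... | i≡j , a≡b = i≡j , cong (_↑ˡ n) a≡b
    injective-joined i j (inj₂ a) (inj₂ b) e
      with A.injective i j a b (trans (sym (stackDice-↑ʳ i a)) (trans e (stackDice-↑ʳ j b)))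
    ... | i≡j , a≡b = i≡j , cong (k ↑ʳ_) a≡b
    injective-joined i j (inj₁ a) (inj₂ b) e =
      contradiction (trans (sym (stackDice-↑ʳ j b)) (trans (sym e) (stackDice-↑ˡ i a))) (<⇒≢ (old<new j i b a))
    injective-joined i j (inj₂ a) (inj₁ b) e =
      contradiction (trans (sym (stackDice-↑ʳ i a)) (trans e (stackDice-↑ˡ j b))) (<⇒≢ (old<new i j a b))

    range-joined : ∀ i s → 1 ≤ stackDice i (join k n s) × stackDice i (join k n s) ≤ m * (k + n)
    range-joined i (inj₁ a) rewrite stackDice-↑ˡ i a =
      ≤-trans (proj₁ (B.range i a)) (m≤n+m _ c) ,
      subst (c + B i a ≤_) c+mk≡m[k+n] (+-monoʳ-≤ c (proj₂ (B.range i a)))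
    range-joined i (inj₂ b) rewrite stackDice-↑ʳ i b =
      proj₁ (A.range i b) , ≤-trans (proj₂ (A.range i b)) (subst (c ≤_) c+mk≡m[k+n] (m≤m+n c (m * k)))

    surjective′ : ∀ v → 1 ≤ v → v ≤ m * (k + n) → ∃ λ i → ∃ λ f → stackDice i f ≡ v
    surjective′ v 1≤v v≤top with v ≤? c
    ... | yes v≤c with A.surjective v 1≤v v≤c
    ...   | i , b , e = i , k ↑ʳ b , trans (stackDice-↑ʳ i b) e
    surjective′ v 1≤v v≤top | no v≰c with B.surjective (v ∸ c) (m<n⇒0<n∸m (≰⇒> v≰c)) v∸c≤mk
      where
      v∸c≤mk : v ∸ c ≤ m * k
      v∸c≤mk = subst (v ∸ c ≤_) (trans (cong (_∸ c) (sym c+mk≡m[k+n])) (m+n∸m≡n c (m * k)))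
                     (∸-monoˡ-≤ c v≤top)
    ...   | i , a , e =
      i , a ↑ˡ n , trans (stackDice-↑ˡ i a) (trans (cong (c +_) e) (m+[n∸m]≡n (<⇒≤ (≰⇒> v≰c))))

  winCount-stackDice : IsPartitionDice m k B → IsPartitionDice m n A → ∀ i j →
    winCount (stackDice i) (stackDice j) ≡ winCount (B i) (B j) + (k * n + winCount (A i) (A j))
  winCount-stackDice pB pA i j =
    trans (winCount-stack (λ a → proj₂ (A.range i a)) (λ b → proj₂ (A.range j b)) (above i) (above j))
          (cong (_+ _) (winCount-+ (B i) (B j) (m * n)))
    where
    module B = IsPartitionDice pB
    module A = IsPartitionDice pA
    above : ∀ i a → m * n < m * n + B i a
    above i a = m<m+n (m * n) (proj₁ (B.range i a))

module _ {m : ℕ} where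

  slot : Fin m → Fin 2 → Fin (m + m)
  slot i zero       = i ↑ˡ m
  slot i (suc zero) = m ↑ʳ opposite i

  -- The faces of mirrorPair i are i + 1 and 2m − i.
  mirrorPair : Fin m → Die 2
  mirrorPair i k = suc (toℕ (slot i k))

  private
    low : ∀ i → toℕ (slot i zero) ≡ toℕ i
    low i = Fin.toℕ-↑ˡ i m

    high : ∀ i → toℕ (slot i (suc zero)) ≡ m + toℕ (opposite i)
    high i = Fin.toℕ-↑ʳ m (opposite i)

    low<high : ∀ i j → toℕ (slot i zero) < toℕ (slot j (suc zero))
    low<high i j = subst₂ _<_ (sym (low i)) (sym (high j)) (≤-trans (Fin.toℕ<n i) (m≤m+n m _))

    opposite-< : ∀ {i j : Fin m} → toℕ i < toℕ j → toℕ (opposite j) < toℕ (opposite i)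
    opposite-< {i} {j} i<j = subst₂ _<_ (sym (Fin.opposite-prop j)) (sym (Fin.opposite-prop i))
                                     (∸-monoʳ-< (s≤s i<j) (Fin.toℕ<n j))

    mirror-low<high : ∀ i j → mirrorPair i zero < mirrorPair j (suc zero)
    mirror-low<high i j = s≤s (low<high i j)

    mirror-low-< : ∀ {i j} → toℕ i < toℕ j → mirrorPair i zero < mirrorPair j zero
    mirror-low-< {i} {j} i<j = s≤s (subst₂ _<_ (sym (low i)) (sym (low j)) i<j)

    mirror-high-< : ∀ {i j} → toℕ i < toℕ j → mirrorPair j (suc zero) < mirrorPair i (suc zero)
    mirror-high-< {i} {j} i<j = s≤s (subst₂ _<_ (sym (high j)) (sym (high i)) (+-monoʳ-< m (opposite-< i<j)))

  slot-injective : ∀ {i j k l} → slot i k ≡ slot j l → i ≡ j × k ≡ l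
  slot-injective {i} {j} {zero} {zero} e = Fin.↑ˡ-injective m i j e , refl
  slot-injective {i} {j} {zero} {suc zero} e = contradiction (cong toℕ e) (<⇒≢ (low<high i j))
  slot-injective {i} {j} {suc zero} {zero} e = contradiction (cong toℕ (sym e)) (<⇒≢ (low<high j i))
  slot-injective {i} {j} {suc zero} {suc zero} e = opposite-injective (Fin.↑ʳ-injective m _ _ e) , refl
    where
    opposite-injective : opposite i ≡ opposite j → i ≡ j
    opposite-injective e = trans (sym (Fin.opposite-involutive i)) (trans (cong opposite e) (Fin.opposite-involutive j))

  slot-surjective : ∀ f → ∃ λ i → ∃ λ k → slot i k ≡ f
  slot-surjective f with splitAt m f in eq
  ... | inj₁ i = i , zero , Fin.splitAt⁻¹-↑ˡ eq
  ... | inj₂ i = opposite i , suc zero , trans (cong (m ↑ʳ_) (Fin.opposite-involutive i)) (Fin.splitAt⁻¹-↑ʳ eq)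

  mirrorPair-partition : IsPartitionDice m 2 mirrorPair
  mirrorPair-partition = record
    { injective  = λ i j k l e → slot-injective (Fin.toℕ-injective (suc-injective e))
    ; range      = λ i k → s≤s z≤n , subst (mirrorPair i k ≤_) m+m≡m*2 (Fin.toℕ<n (slot i k))
    ; surjective = surjective′
    }
    where
    m+m≡m*2 : m + m ≡ m * 2
    m+m≡m*2 = trans (cong (m +_) (sym (*-identityʳ m))) (sym (*-suc m 1))

    surjective′ : ∀ v → 1 ≤ v → v ≤ m * 2 → ∃ λ i → ∃ λ k → mirrorPair i k ≡ v
    surjective′ (suc w) _ w<m*2 with slot-surjective (fromℕ< (subst (suc w ≤_) (sym m+m≡m*2) w<m*2))
    ... | i , k , e = i , k , cong suc (trans (cong toℕ e) (Fin.toℕ-fromℕ< _))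

  -- If i < j, the high face of i beats both faces of j; if j < i, each face of i beats exactly one of j.
  winCount-mirrorPair : ∀ {i j} → i ≢ j → winCount (mirrorPair i) (mirrorPair j) ≡ 2
  winCount-mirrorPair {i} {j} i≢j with Fin.<-cmp i j
  ... | tri< i<j _ _ = cong₂ (λ a b → a + (b + 0))
    (countBelow-none {Y = mirrorPair j} λ { zero       → <⇒≤ (mirror-low-< i<j)
                                          ; (suc zero) → <⇒≤ (mirror-low<high i j) })
    (countBelow-all {Y = mirrorPair j} λ { zero → mirror-low<high j i ; (suc zero) → mirror-high-< i<j })
  ... | tri≈ _ i≡j _ = contradiction i≡j i≢j
  ... | tri> _ _ j<i = cong₂ (λ a b → a + (b + 0))
    (trans (countBelow-∷-< {c = mirrorPair j zero} {Y = mirrorPair j ∘ suc} (mirror-low-< j<i))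
           (cong suc (countBelow-none {Y = mirrorPair j ∘ suc} λ { zero → <⇒≤ (mirror-low<high i j) })))
    (trans (countBelow-∷-< {c = mirrorPair j zero} {Y = mirrorPair j ∘ suc} (mirror-low<high j i))
           (cong suc (countBelow-none {Y = mirrorPair j ∘ suc} λ { zero → <⇒≤ (mirror-high-< j<i) })))

beats-margin-+2 : ∀ n w → n * n < 2 * w ⇔ (2 + n) * (2 + n) < 2 * (2 + (2 * n + w))
beats-margin-+2 n w = mk⇔
  (λ h → subst₂ _<_ (sym (square n)) (sym (double n w)) (+-monoˡ-< (4 * suc n) h))
  (λ h → +-cancelʳ-< (4 * suc n) _ _ (subst₂ _<_ (square n) (double n w) h))
  where
  square : ∀ n → (2 + n) * (2 + n) ≡ n * n + 4 * suc n
  square = solve-∀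
  double : ∀ n w → 2 * (2 + (2 * n + w)) ≡ 2 * w + 4 * suc n
  double = solve-∀

module _ {m n : ℕ} {A : Fin m → Die n} (pA : IsPartitionDice m n A) where

  extendDice : Fin m → Die (2 + n)
  extendDice = stackDice mirrorPair A

  extendDice-partition : IsPartitionDice m (2 + n) extendDice
  extendDice-partition = stack-partition mirrorPair A mirrorPair-partition pA

  wins-extendDice : ∀ {i j} → i ≢ j → wins (extendDice i) (extendDice j) ≡ 2 + (2 * n + wins (A i) (A j))
  wins-extendDice {i} {j} i≢j = begin
    wins (extendDice i) (extendDice j)
      ≡⟨ wins≡winCount (extendDice i) (extendDice j) ⟩
    winCount (extendDice i) (extendDice j)
      ≡⟨ winCount-stackDice mirrorPair A mirrorPair-partition pA i j ⟩
    winCount (mirrorPair i) (mirrorPair j) + (2 * n + winCount (A i) (A j))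
      ≡⟨ cong₂ (λ a w → a + (2 * n + w)) (winCount-mirrorPair i≢j) (sym (wins≡winCount (A i) (A j))) ⟩
    2 + (2 * n + wins (A i) (A j))
      ∎
    where open ≡-Reasoning

  beats-extendDice : ∀ {i j} → i ≢ j → Beats (extendDice i) (extendDice j) ⇔ Beats (A i) (A j)
  beats-extendDice {i} {j} i≢j = mk⇔
    (from ∘ subst (λ w → (2 + n) * (2 + n) < 2 * w) (wins-extendDice i≢j))
    (subst (λ w → (2 + n) * (2 + n) < 2 * w) (sym (wins-extendDice i≢j)) ∘ to)
    where open Equivalence (beats-margin-+2 n (wins (A i) (A j)))

module _ {m : ℕ} {G : Orientation m} where

  realization-+2 : ∀ {n} → Realization G n → Realization G (2 + n)
  realization-+2 R = record
    { dice      = extendDice partition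
    ; partition = extendDice-partition partition
    ; correct   = λ i j i≢j → let open Equivalence (beats-extendDice partition i≢j) in
                    proj₁ (correct i j i≢j) ∘ to , from ∘ proj₂ (correct i j i≢j)
    }
    where open Realization R

  realization-≥ : ∀ {n} → Realization G n → Realization G (suc n) → ∀ k → n ≤ k → Realization G k
  realization-≥ {n} Rₙ Rₙ₊₁ k n≤k = subst (Realization G) (m∸n+n≡m n≤k) (from-offset (k ∸ n))
    where
    from-offset : ∀ d → Realization G (d + n)
    from-offset zero          = Rₙ
    from-offset (suc zero)    = Rₙ₊₁
    from-offset (suc (suc d)) = realization-+2 (from-offset d)

realization-cong : ∀ {m n} {G H : Orientation m} →
  (∀ i j → i ≢ j → Orientation.E G i j ≡ Orientation.E H i j) → Realization G n → Realization H n
realization-cong G≈H R = record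
  { dice      = dice
  ; partition = partition
  ; correct   = λ i j i≢j → let eq = G≈H i j i≢j in
                  subst (_≡ true) eq ∘ proj₁ (correct i j i≢j) ,
                  proj₂ (correct i j i≢j) ∘ subst (_≡ true) (sym eq)
  }
  where open Realization R

module _ {m n : ℕ} (A : Fin m → Die n) where

  private
    LabelsHit : Set
    LabelsHit = ∀ (v : Fin (m * n)) → ∃ λ i → ∃ λ k → A i k ≡ suc (toℕ v)

    labelsHit⇒surjective : LabelsHit → ∀ v → 1 ≤ v → v ≤ m * n → ∃ λ i → ∃ λ k → A i k ≡ v
    labelsHit⇒surjective hits (suc v) _ v<mn with hits (fromℕ< v<mn)
    ... | i , k , eq = i , k , trans eq (cong suc (Fin.toℕ-fromℕ< v<mn))

  isPartitionDice? : Dec (IsPartitionDice m n A)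
  isPartitionDice? = map′
    (λ (inj , rng , hits) → record { injective = inj ; range = rng ; surjective = labelsHit⇒surjective hits })
    (λ p → let open IsPartitionDice p in
             injective , range , λ v → surjective (suc (toℕ v)) (s≤s z≤n) (Fin.toℕ<n v))
    (injective? ×-dec range? ×-dec labelsHit?)
    where
    injective? = all? λ i → all? λ j → all? λ k → all? λ l →
                   (A i k ≟ A j l) →-dec (i Fin.≟ j ×-dec k Fin.≟ l)
    range?     = all? λ i → all? λ k → 1 ≤? A i k ×-dec A i k ≤? m * n
    labelsHit? = all? λ v → any? λ i → any? λ k → A i k ≟ suc (toℕ v)

  correct? : (G : Orientation m) → Dec (∀ i j → i ≢ j → (Beats (A i) (A j) → Orientation.E G i j ≡ true) ×
                                                       (Orientation.E G i j ≡ true → Beats (A i) (A j)))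
  correct? G = all? λ i → all? λ j → ¬? (i Fin.≟ j) →-dec
    ((beats? i j →-dec (E i j Bool.≟ true)) ×-dec ((E i j Bool.≟ true) →-dec beats? i j))
    where
    open Orientation G
    beats? = λ i j → n * n <? 2 * wins (A i) (A j)

  realizationByDecision : {G : Orientation m} → {True isPartitionDice?} → {True (correct? G)} → Realization G n
  realizationByDecision {G} {p} {c} = record { dice = A ; partition = toWitness p ; correct = toWitness c }

tournament3 : Bool → Bool → Bool → Orientation 3
tournament3 a b c = record
  { E          = E
  ; loopless   = λ { 0F → refl ; 1F → refl ; 2F → refl }
  ; tournament = antisymmetric
  }
  where
  E : Fin 3 → Fin 3 → Bool
  E 0F 1F = a
  E 0F 2F = b
  E 1F 2F = c
  E 1F 0F = not a
  E 2F 0F = not b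
  E 2F 1F = not c
  E _  _  = false

  antisymmetric : ∀ i j → i ≢ j → E i j ≢ E j i
  antisymmetric 0F 1F _ = Bool.not-¬ refl
  antisymmetric 0F 2F _ = Bool.not-¬ refl
  antisymmetric 1F 2F _ = Bool.not-¬ refl
  antisymmetric 1F 0F _ = Bool.not-¬ refl ∘ sym
  antisymmetric 2F 0F _ = Bool.not-¬ refl ∘ sym
  antisymmetric 2F 1F _ = Bool.not-¬ refl ∘ sym
  antisymmetric 0F 0F i≢i = contradiction refl i≢i
  antisymmetric 1F 1F i≢i = contradiction refl i≢i
  antisymmetric 2F 2F i≢i = contradiction refl i≢i

module _ (G : Orientation 3) where
  open Orientation G

  tournament3-≗ : ∀ i j → i ≢ j → Orientation.E (tournament3 (E 0F 1F) (E 0F 2F) (E 1F 2F)) i j ≡ E i j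
  tournament3-≗ 0F 1F _ = refl
  tournament3-≗ 0F 2F _ = refl
  tournament3-≗ 1F 2F _ = refl
  tournament3-≗ 1F 0F _ = sym (Bool.¬-not (tournament 1F 0F λ ()))
  tournament3-≗ 2F 0F _ = sym (Bool.¬-not (tournament 2F 0F λ ()))
  tournament3-≗ 2F 1F _ = sym (Bool.¬-not (tournament 2F 1F λ ()))
  tournament3-≗ 0F 0F i≢i = contradiction refl i≢i
  tournament3-≗ 1F 1F i≢i = contradiction refl i≢i
  tournament3-≗ 2F 2F i≢i = contradiction refl i≢i

stacked : ∀ {n} → ℕ → ℕ → ℕ → Fin 3 → Die n
stacked {n} x y z i k = (x ∷ y ∷ z ∷ []) i * n + suc (toℕ k)

cyclic₃ : Fin 3 → Die 3
cyclic₃ = (2 ∷ 4 ∷ 9 ∷ []) ∷ (1 ∷ 6 ∷ 8 ∷ []) ∷ (3 ∷ 5 ∷ 7 ∷ []) ∷ []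

cyclic₄ : Fin 3 → Die 4
cyclic₄ = (1 ∷ 3 ∷ 10 ∷ 11 ∷ []) ∷ (2 ∷ 7 ∷ 8 ∷ 9 ∷ []) ∷ (4 ∷ 5 ∷ 6 ∷ 12 ∷ []) ∷ []

swap₁₂ : Fin 3 → Fin 3
swap₁₂ = 0F ∷ 2F ∷ 1F ∷ []

tournament3-realizations : ∀ a b c → Realization (tournament3 a b c) 3 × Realization (tournament3 a b c) 4
tournament3-realizations true  true  true  = realizationByDecision (stacked 2 1 0) , realizationByDecision (stacked 2 1 0)
tournament3-realizations true  true  false = realizationByDecision (stacked 2 0 1) , realizationByDecision (stacked 2 0 1)
tournament3-realizations true  false false = realizationByDecision (stacked 1 0 2) , realizationByDecision (stacked 1 0 2)
tournament3-realizations false true  true  = realizationByDecision (stacked 1 2 0) , realizationByDecision (stacked 1 2 0)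
tournament3-realizations false false true  = realizationByDecision (stacked 0 2 1) , realizationByDecision (stacked 0 2 1)
tournament3-realizations false false false = realizationByDecision (stacked 0 1 2) , realizationByDecision (stacked 0 1 2)
tournament3-realizations true  false true  = realizationByDecision cyclic₃ , realizationByDecision cyclic₄
tournament3-realizations false true  false =
  realizationByDecision (cyclic₃ ∘ swap₁₂) , realizationByDecision (cyclic₄ ∘ swap₁₂)

corollary5p4 : (G : Orientation 3) → (n : ℕ) → 3 ≤ n → Realization G n
corollary5p4 G n 3≤n =
  let R₃ , R₄ = tournament3-realizations (E 0F 1F) (E 0F 2F) (E 1F 2F)
  in realization-cong (tournament3-≗ G) (realization-≥ R₃ R₄ n 3≤n)
  where open Orientation G
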